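{- If a graph $G$ can be obtained from a subdivision of the prism by adding one edge between two (non-adjacent) vertices of it, then $G$ has a proper $K_4$-subdivision.
   Context: Graphs are finite and simple. The prism is the Cartesian product $K_3\square K_2$ (two disjoint triangles joined by a perfect matching). A subdivision of a graph $H$ is obtained by replacing edges of $H$ by internally disjoint paths. $G$ has a proper $K_4$-subdivision if there is a vertex $v\in V(G)$ such that $G\setminus v$ contains a subdivision of $K_4$ as a subgraph. -}

module Defs where

open import Data.Nat using (ℕ; zero; suc)
open import Data.Fin using (Fin; zero; suc; punchIn)
open import Data.List using (List; []; _∷_; _++_; length; lookup)
open import Data.List.Membership.Propositional using (_∈_)
open import Data.List.Relation.Unary.Linked using (Linked)
open import Data.List.Relation.Unary.Unique.Propositional using (Unique)
open import Data.Product using (Σ; ∃; ∃-syntax; _×_; _,_; proj₁; proj₂)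
open import Data.Sum using (_⊎_)
open import Data.Empty using (⊥)
open import Relation.Nullary using (¬_)
open import Relation.Binary.PropositionalEquality using (_≡_; _≢_)

record Graph (n : ℕ) : Set₁ where
  field
    Adj     : Fin n → Fin n → Set
    sym     : ∀ {u v} → Adj u v → Adj v u
    irrefl  : ∀ {u} → ¬ Adj u u
open Graph public

delete : ∀ {m} → Graph (suc m) → Fin (suc m) → Graph m
delete G v = record
  { Adj    = λ i j → Adj G (punchIn v i) (punchIn v j)
  ; sym    = sym G
  ; irrefl = irrefl G }

-- A pattern graph H given by vertex count and its list of edges
-- (each edge listed once, as a pair of distinct vertices).
record Pattern : Set where
  field
    size  : ℕ
    edges : List (Fin size × Fin size)
open Pattern public

Disjoint : ∀ {A : Set} → List A → List A → Set
Disjoint xs ys = ∀ {z} → z ∈ xs → z ∈ ys → ⊥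

-- A subdivision of the pattern H contained as a subgraph of G:
-- branch vertices (injective), and for every edge ab of H a path in G
-- from branch a to branch b with internal vertex list `inner e`, such that
-- internal vertices are not branch vertices, and distinct edges have
-- disjoint interiors.
record TopEmbedding {n : ℕ} (H : Pattern) (G : Graph n) : Set where
  field
    branch     : Fin (size H) → Fin n
    branch-inj : ∀ {a b} → branch a ≡ branch b → a ≡ b
    inner      : Fin (length (edges H)) → List (Fin n)
  pathOf : Fin (length (edges H)) → List (Fin n)
  pathOf e = branch (proj₁ (lookup (edges H) e))
             ∷ (inner e ++ branch (proj₂ (lookup (edges H) e)) ∷ [])
  field
    path-adj    : ∀ e → Linked (Adj G) (pathOf e)
    path-unique : ∀ e → Unique (pathOf e)
    inner-nonbranch : ∀ e a → ¬ (branch a ∈ inner e)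
    inner-disj  : ∀ e e' → e ≢ e' → Disjoint (inner e) (inner e')
open TopEmbedding public

ContainsSubdivision : ∀ {n} → Pattern → Graph n → Set
ContainsSubdivision H G = TopEmbedding H G

-- G *is* a subdivision of H: a subdivision of H in G that uses every
-- vertex and every edge of G.
IsSubdivisionOf : ∀ {n} → Graph n → Pattern → Set
IsSubdivisionOf {n} G H =
  Σ (TopEmbedding H G) λ T →
    (∀ (v : Fin n) → (∃[ a ] branch T a ≡ v) ⊎ (∃[ e ] v ∈ inner T e))
    × (∀ u v → Adj G u v →
         ∃[ e ] ∃[ xs ] ∃[ ys ] (pathOf T e ≡ xs ++ u ∷ v ∷ ys
                                 ⊎ pathOf T e ≡ xs ++ v ∷ u ∷ ys))

-- K4 and the prism K3 □ K2 (triangles 012, 345; matching 0-3, 1-4, 2-5).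
K4 : Pattern
K4 = record
  { size = 4
  ; edges = (0F , 1F) ∷ (0F , 2F) ∷ (0F , 3F) ∷ (1F , 2F) ∷ (1F , 3F) ∷ (2F , 3F) ∷ [] }
  where
  0F 1F 2F 3F : Fin 4
  0F = zero
  1F = suc zero
  2F = suc (suc zero)
  3F = suc (suc (suc zero))

Prism : Pattern
Prism = record
  { size = 6
  ; edges = (v0 , v1) ∷ (v1 , v2) ∷ (v0 , v2)
          ∷ (v3 , v4) ∷ (v4 , v5) ∷ (v3 , v5)
          ∷ (v0 , v3) ∷ (v1 , v4) ∷ (v2 , v5) ∷ [] }
  where
  v0 v1 v2 v3 v4 v5 : Fin 6
  v0 = zero
  v1 = suc zero
  v2 = suc (suc zero)
  v3 = suc (suc (suc zero))
  v4 = suc (suc (suc (suc zero)))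
  v5 = suc (suc (suc (suc (suc zero))))

-- G has a proper K4-subdivision: some vertex v with G ∖ v ⊇ subdivision of K4.
HasProperK4Subdivision : ∀ {n} → Graph n → Set
HasProperK4Subdivision {zero}  G = ⊥
HasProperK4Subdivision {suc m} G =
  Σ (Fin (suc m)) λ v → ContainsSubdivision K4 (delete G v)

AddEdge : ∀ {n} → Graph n → Fin n → Fin n → Graph n → Set
AddEdge S x y G =
  x ≢ y × ¬ Adj S x y ×
  (∀ u v → (Adj G u v → Adj S u v ⊎ ((u ≡ x × v ≡ y) ⊎ (u ≡ y × v ≡ x)))
         × (Adj S u v ⊎ ((u ≡ x × v ≡ y) ⊎ (u ≡ y × v ≡ x)) → Adj G u v))

-- Locate the ends x, y of the added edge at branch vertices or inside subdivided edges of the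
-- prism S. If both lie on one subdivided edge P, replacing the segment of P between them by xy
-- skips an inner vertex v of P (x and y are not adjacent in S); the rerouted prism lives in
-- G ∖ v and still contains a subdivided K4. Otherwise some theta of the prism (a triangle edge
-- pq, the other way round that triangle, and a p–q path through the other triangle) carries x
-- and y on two different paths, possibly after moving x to an end of its subdivided edge; xy
-- then bridges the theta into a subdivided K4 that misses a branch vertex of the prism. Which
-- case applies to which positions of x and y is checked by evaluation.

module Submission where

open import Defs hiding (Disjoint)
open import Data.Nat using (zero; suc)
open import Data.Empty using (⊥; ⊥-elim)
open import Data.Unit using (⊤)
open import Data.Fin using (Fin; zero; suc; punchIn; punchOut; #_)
open import Data.Fin.Properties using (_≟_; punchIn-punchOut)
import Data.Fin.Properties as Fin
open import Data.List
  using (List; []; _∷_; _++_; length; lookup; map; tabulate; concat; concatMap; allFin; reverse)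
open import Data.List.Properties using (++-assoc; map-++; reverse-++; unfold-reverse)
open import Data.List.Membership.Propositional using (_∈_; _∉_)
open import Data.List.Membership.Propositional.Properties
  using (∈-++⁺ˡ; ∈-++⁺ʳ; ∈-++⁻; ∈-∃++; ∈-map⁺; ∈-tabulate⁺; ∈-concat⁺′; ∈-allFin)
open import Data.List.Relation.Unary.Any as Any using (Any; here; there; any?)
import Data.List.Relation.Unary.Any.Properties as Any
open import Data.List.Relation.Unary.All as All using (All; []; _∷_; all?)
import Data.List.Relation.Unary.All.Properties as All
open import Data.List.Relation.Unary.AllPairs as AllPairs using (AllPairs; []; _∷_; allPairs?)
open import Data.List.Relation.Unary.Linked as Linked using (Linked; []; [-]; _∷_)
import Data.List.Relation.Unary.Linked.Properties as Linked
open import Data.List.Relation.Unary.Unique.Propositional using (Unique)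
import Data.List.Relation.Unary.Unique.Propositional.Properties as Unique
open import Data.List.Relation.Binary.Pointwise using (Pointwise; []; _∷_)
open import Data.List.Relation.Binary.Disjoint.Propositional using (Disjoint)
open import Data.List.Relation.Binary.Subset.Propositional using (_⊆_)
open import Data.List.Relation.Binary.Permutation.Propositional using (_↭_; ↭-sym; ↭⇒↭ₛ)
open import Data.List.Relation.Binary.Permutation.Propositional.Properties
  using (↭-reverse; ∈-resp-↭; ++-commutativeMonoid)
import Data.List.Relation.Binary.Permutation.Setoid.Properties as Permutationₛ
open import Data.Product using (Σ; ∃-syntax; _×_; _,_; proj₁; proj₂)
open import Data.Sum using (_⊎_; inj₁; inj₂)
open import Data.Sum.Properties using (≡-dec)
open import Data.Vec as Vec using (_∷_; [])
open import Function using (_∘_; id)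
open import Relation.Nullary using (¬_; Dec; yes; no)
open import Relation.Nullary.Decidable using (_×-dec_; _⊎-dec_; _→-dec_; ¬?; toWitness)
open import Relation.Binary.Definitions using (Symmetric)
open import Relation.Binary.PropositionalEquality
  using (_≡_; _≢_; refl; cong; cong₂; subst; trans; setoid; module ≡-Reasoning)
  renaming (sym to ≡-sym)

module _ {A : Set} where

  Unique-++⁻ : ∀ xs {ys : List A} → Unique (xs ++ ys) → Unique xs × Unique ys × Disjoint xs ys
  Unique-++⁻ []       u          = [] , u , λ ()
  Unique-++⁻ (x ∷ xs) (x∉ ∷ u) with Unique-++⁻ xs u
  ... | uxs , uys , xs#ys =
    All.++⁻ˡ xs x∉ ∷ uxs , uys ,
    λ { (here refl , x∈ys) → All.lookup (All.++⁻ʳ xs x∉) x∈ys refl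
      ; (there v∈xs , v∈ys) → xs#ys (v∈xs , v∈ys) }

  Unique-resp-↭ : ∀ {xs ys : List A} → xs ↭ ys → Unique xs → Unique ys
  Unique-resp-↭ xs↭ys = Permutationₛ.Unique-resp-↭ (setoid A) (↭⇒↭ₛ xs↭ys)

  Unique-reverse : ∀ {xs : List A} → Unique xs → Unique (reverse xs)
  Unique-reverse {xs} = Unique-resp-↭ (↭-sym (↭-reverse xs))

  reverse-∷∷ : ∀ (x y : A) ys → reverse (x ∷ y ∷ ys) ≡ reverse ys ++ y ∷ x ∷ []
  reverse-∷∷ x y ys = begin
    reverse (x ∷ y ∷ ys)           ≡⟨ unfold-reverse x (y ∷ ys) ⟩
    reverse (y ∷ ys) ++ x ∷ []     ≡⟨ cong (_++ x ∷ []) (unfold-reverse y ys) ⟩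
    (reverse ys ++ y ∷ []) ++ x ∷ [] ≡⟨ ++-assoc (reverse ys) (y ∷ []) (x ∷ []) ⟩
    reverse ys ++ y ∷ x ∷ []       ∎
    where open ≡-Reasoning

  tabulate-injective : ∀ {k} {f : Fin k → A} → Unique (tabulate f) → ∀ {i j} → f i ≡ f j → i ≡ j
  tabulate-injective (f₀∉ ∷ u) {zero}  {zero}  _  = refl
  tabulate-injective (f₀∉ ∷ u) {zero}  {suc j} eq = ⊥-elim (All.lookup f₀∉ (∈-tabulate⁺ j) eq)
  tabulate-injective (f₀∉ ∷ u) {suc i} {zero}  eq = ⊥-elim (All.lookup f₀∉ (∈-tabulate⁺ i) (≡-sym eq))
  tabulate-injective (f₀∉ ∷ u) {suc i} {suc j} eq = cong suc (tabulate-injective u eq)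

  ∈-concat-tabulate : ∀ {k} (g : Fin k → List A) i {z} → z ∈ g i → z ∈ concat (tabulate g)
  ∈-concat-tabulate g i z∈ = ∈-concat⁺′ z∈ (∈-tabulate⁺ i)

  concat-tabulate-unique : ∀ {k} (g : Fin k → List A) → Unique (concat (tabulate g)) → ∀ i → Unique (g i)
  concat-tabulate-unique g u zero    = proj₁ (Unique-++⁻ (g zero) u)
  concat-tabulate-unique g u (suc i) =
    concat-tabulate-unique (g ∘ suc) (proj₁ (proj₂ (Unique-++⁻ (g zero) u))) i

  concat-tabulate-disjoint : ∀ {k} (g : Fin k → List A) → Unique (concat (tabulate g)) →
                             ∀ i j → i ≢ j → Disjoint (g i) (g j)
  concat-tabulate-disjoint g u zero zero i≢j = ⊥-elim (i≢j refl)
  concat-tabulate-disjoint g u zero (suc j) _ (z∈ , z∈′) =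
    proj₂ (proj₂ (Unique-++⁻ (g zero) u)) (z∈ , ∈-concat-tabulate (g ∘ suc) j z∈′)
  concat-tabulate-disjoint g u (suc i) zero _ (z∈ , z∈′) =
    proj₂ (proj₂ (Unique-++⁻ (g zero) u)) (z∈′ , ∈-concat-tabulate (g ∘ suc) i z∈)
  concat-tabulate-disjoint g u (suc i) (suc j) i≢j =
    concat-tabulate-disjoint (g ∘ suc) (proj₁ (proj₂ (Unique-++⁻ (g zero) u))) i j (i≢j ∘ cong suc)

  module _ {R : A → A → Set} where

    Linked-join : ∀ xs {y ys} → Linked R (xs ++ y ∷ []) → Linked R (y ∷ ys) → Linked R (xs ++ y ∷ ys)
    Linked-join []           _         l = l
    Linked-join (x ∷ [])     (r ∷ _)   l = r ∷ l
    Linked-join (x ∷ x′ ∷ xs) (r ∷ l₁) l = r ∷ Linked-join (x′ ∷ xs) l₁ l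

    Linked-prefix : ∀ xs {y ys} → Linked R (xs ++ y ∷ ys) → Linked R (xs ++ y ∷ [])
    Linked-prefix []            _       = [-]
    Linked-prefix (x ∷ [])      (r ∷ _) = r ∷ [-]
    Linked-prefix (x ∷ x′ ∷ xs) (r ∷ l) = r ∷ Linked-prefix (x′ ∷ xs) l

    Linked-suffix : ∀ xs {ys} → Linked R (xs ++ ys) → Linked R ys
    Linked-suffix []       l = l
    Linked-suffix (x ∷ xs) l = Linked-suffix xs (Linked.tail l)

    Linked-reverse : Symmetric R → ∀ {xs} → Linked R xs → Linked R (reverse xs)
    Linked-reverse sym {[]}         l       = l
    Linked-reverse sym {x ∷ []}     l       = [-]
    Linked-reverse sym {x ∷ y ∷ ys} (r ∷ l) =
      subst (Linked R) (≡-sym (reverse-∷∷ x y ys))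
        (Linked-join (reverse ys) (subst (Linked R) (unfold-reverse y ys) (Linked-reverse sym l))
          (sym r ∷ [-]))

record Path {V : Set} (R : V → V → Set) (u w : V) : Set where
  constructor path
  field
    interior : List V
    linked   : Linked R (u ∷ interior ++ w ∷ [])
    unique   : Unique (u ∷ interior ++ w ∷ [])
open Path public

module _ {V : Set} {R : V → V → Set} where

  single : ∀ {u w} → R u w → u ≢ w → Path R u w
  single r u≢w = path [] (r ∷ [-]) ((u≢w ∷ []) ∷ [] ∷ [])

  interior-unique : ∀ {u w} (P : Path R u w) → Unique (interior P)
  interior-unique (path I _ (_ ∷ uq)) = proj₁ (Unique-++⁻ I uq)

  reversePath : Symmetric R → ∀ {u w} → Path R u w → Path R w u
  reversePath sym {u} {w} (path I l uq) =
    path (reverse I) (subst (Linked R) eq (Linked-reverse sym l)) (subst Unique eq (Unique-reverse uq))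
    where
    eq : reverse (u ∷ I ++ w ∷ []) ≡ w ∷ reverse I ++ u ∷ []
    eq = begin
      reverse (u ∷ I ++ w ∷ [])     ≡⟨ unfold-reverse u (I ++ w ∷ []) ⟩
      reverse (I ++ w ∷ []) ++ u ∷ [] ≡⟨ cong (_++ u ∷ []) (reverse-++ I (w ∷ [])) ⟩
      w ∷ reverse I ++ u ∷ []        ∎
      where open ≡-Reasoning

  join : ∀ {u v w} (P : Path R u v) (Q : Path R v w) →
         Disjoint (u ∷ interior P) (interior Q ++ w ∷ []) → Path R u w
  join {u} {v} {w} (path I l uq) (path J l′ uq′) d =
    path (I ++ v ∷ J)
      (subst (Linked R) eq (Linked-join (u ∷ I) l l′))
      (subst Unique eq (Unique.++⁺ uI uq′ apart))
    where
    eq : (u ∷ I) ++ v ∷ J ++ w ∷ [] ≡ u ∷ (I ++ v ∷ J) ++ w ∷ []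
    eq = cong (u ∷_) (≡-sym (++-assoc I (v ∷ J) (w ∷ [])))
    uI = proj₁ (Unique-++⁻ (u ∷ I) uq)
    v∉ = proj₂ (proj₂ (Unique-++⁻ (u ∷ I) uq))
    apart : Disjoint (u ∷ I) (v ∷ J ++ w ∷ [])
    apart (z∈ , here refl) = v∉ (z∈ , here refl)
    apart (z∈ , there z∈′) = d (z∈ , z∈′)

  record Split {u w} (P : Path R u w) (x : V) : Set where
    field
      before     : Path R u x
      after      : Path R x w
      interior-≡ : interior P ≡ interior before ++ x ∷ interior after
      separated  : Disjoint (u ∷ interior before) (x ∷ interior after ++ w ∷ [])

  split : ∀ {u w x} (P : Path R u w) → x ∈ interior P → Split P x
  split {u} {w} {x} (path I l uq) x∈I with ∈-∃++ x∈I
  ... | A , B , refl = record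
    { before     = path A (Linked-prefix (u ∷ A) l′) (Unique.++⁺ uA ([] ∷ []) x∉A)
    ; after      = path B (Linked-suffix (u ∷ A) l′) uB
    ; interior-≡ = refl
    ; separated  = d }
    where
    eq : (A ++ x ∷ B) ++ w ∷ [] ≡ A ++ x ∷ B ++ w ∷ []
    eq = ++-assoc A (x ∷ B) (w ∷ [])
    l′ = subst (λ zs → Linked R (u ∷ zs)) eq l
    parts = Unique-++⁻ (u ∷ A) (subst (λ zs → Unique (u ∷ zs)) eq uq)
    uA = proj₁ parts
    uB = proj₁ (proj₂ parts)
    d = proj₂ (proj₂ parts)
    x∉A : Disjoint (u ∷ A) (x ∷ [])
    x∉A (z∈ , here refl) = d (z∈ , here refl)

module _ {V : Set} {R R′ : V → V → Set} (R⊆R′ : ∀ {a b} → R a b → R′ a b) where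

  mapPath : ∀ {u w} → Path R u w → Path R′ u w
  mapPath (path I l uq) = path I (Linked.map R⊆R′ l) uq

  record Shortcut {u w} (P : Path R u w) : Set where
    field
      bypass     : Path R′ u w
      interior-⊆ : interior bypass ⊆ interior P
      skipped    : V
      skipped∈   : skipped ∈ interior P
      skipped∉   : skipped ∉ interior bypass

  shortcut-from-start : ∀ {u w y} (P : Path R u w) → y ∈ interior P ++ w ∷ [] →
                        ¬ R u y → R′ u y → Shortcut P
  shortcut-from-start P y∈ ¬uy uy with ∈-++⁻ (interior P) y∈
  shortcut-from-start (path [] (r ∷ _) _) _ ¬uy uy | inj₂ (here refl) = ⊥-elim (¬uy r)
  shortcut-from-start (path (s ∷ I) _ (u∉ ∷ _)) _ ¬uy uy | inj₂ (here refl) = record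
    { bypass = single uy (All.lookup u∉ (∈-++⁺ʳ (s ∷ I) (here refl)))
    ; interior-⊆ = λ () ; skipped = s ; skipped∈ = here refl ; skipped∉ = λ () }
  ... | inj₁ y∈I = from-split (split P y∈I)
    where
    from-split : Split P _ → Shortcut P
    from-split record { before = path [] (r ∷ _) _ } = ⊥-elim (¬uy r)
    from-split record { before = path (s ∷ A) _ _ ; after = Q ; interior-≡ = I≡ ; separated = d } =
      record
        { bypass = join (single uy (λ u≡y → d (here refl , here u≡y))) (mapPath Q)
                     (λ { (here refl , z∈) → d (here refl , there z∈) })
        ; interior-⊆ = λ z∈ → subst (_ ∈_) (≡-sym I≡) (∈-++⁺ʳ (s ∷ A) z∈)
        ; skipped = s
        ; skipped∈ = subst (_ ∈_) (≡-sym I≡) (here refl)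
        ; skipped∉ = λ { (here refl) → d (there (here refl) , here refl)
                       ; (there s∈) → d (there (here refl) , there (∈-++⁺ˡ s∈)) } }

  shortcut : Symmetric R → Symmetric R′ → ∀ {u w x y} (P : Path R u w) →
             x ∈ u ∷ interior P ++ w ∷ [] → y ∈ u ∷ interior P ++ w ∷ [] →
             x ≢ y → ¬ R x y → R′ x y → Shortcut P
  shortcut sym sym′ P (here refl) (here refl) x≢y ¬xy xy = ⊥-elim (x≢y refl)
  shortcut sym sym′ P (here refl) (there y∈) x≢y ¬xy xy = shortcut-from-start P y∈ ¬xy xy
  shortcut sym sym′ P (there x∈) (here refl) x≢y ¬xy xy =
    shortcut-from-start P x∈ (¬xy ∘ sym) (sym′ xy)
  shortcut sym sym′ (path [] _ _) (there (here refl)) (there (here refl)) x≢y ¬xy xy =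
    ⊥-elim (x≢y refl)
  shortcut sym sym′ (path (i ∷ I) (r ∷ l) (u∉ ∷ uq@(i∉ ∷ _))) (there x∈) (there y∈) x≢y ¬xy xy =
    prepend (shortcut sym sym′ (path I l uq) x∈ y∈ x≢y ¬xy xy)
    where
    prepend : Shortcut (path I l uq) → Shortcut (path (i ∷ I) (r ∷ l) (u∉ ∷ uq))
    prepend s = record
      { bypass = path (i ∷ interior b) (R⊆R′ r ∷ linked b)
                   (All.¬Any⇒All¬ _ (λ u∈ → All.lookup u∉ (widen u∈) refl) ∷ unique b)
      ; interior-⊆ = λ { (here refl) → here refl ; (there z∈) → there (Shortcut.interior-⊆ s z∈) }
      ; skipped = Shortcut.skipped s
      ; skipped∈ = there (Shortcut.skipped∈ s)
      ; skipped∉ = λ { (here refl) → All.lookup i∉ (∈-++⁺ˡ (Shortcut.skipped∈ s)) refl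
                     ; (there z∈) → Shortcut.skipped∉ s z∈ } }
      where
      b = Shortcut.bypass s
      widen : ∀ {z} → z ∈ i ∷ interior b ++ _ ∷ [] → z ∈ i ∷ I ++ _ ∷ []
      widen (here refl) = here refl
      widen (there z∈) with ∈-++⁻ (interior b) z∈
      ... | inj₁ z∈b = there (∈-++⁺ˡ (Shortcut.interior-⊆ s z∈b))
      ... | inj₂ z∈w = there (∈-++⁺ʳ I z∈w)

source target : (H : Pattern) → Fin (length (edges H)) → Fin (size H)
source H e = proj₁ (lookup (edges H) e)
target H e = proj₂ (lookup (edges H) e)

Loopless : Pattern → Set
Loopless H = ∀ e → source H e ≢ target H e

loopless? : ∀ H → Dec (Loopless H)
loopless? H = Fin.all? (λ e → ¬? (source H e ≟ target H e))

module _ {n} {G : Graph n} {H : Pattern} where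

  VertexOf : TopEmbedding H G → Fin n → Set
  VertexOf T z = (∃[ a ] branch T a ≡ z) ⊎ (∃[ e ] z ∈ inner T e)

  edgePath : (T : TopEmbedding H G) (e : Fin (length (edges H))) →
             Path (Adj G) (branch T (source H e)) (branch T (target H e))
  edgePath T e = path (inner T e) (path-adj T e) (path-unique T e)

  embedding : Loopless H → (b : Fin (size H) → Fin n) (I : Fin (length (edges H)) → List (Fin n)) →
              (∀ e → Linked (Adj G) (b (source H e) ∷ I e ++ b (target H e) ∷ [])) →
              Unique (tabulate b ++ concat (tabulate I)) → TopEmbedding H G
  embedding loopless b I adj u = record
    { branch = b ; branch-inj = tabulate-injective ub ; inner = I
    ; path-adj = adj ; path-unique = path-unique′
    ; inner-nonbranch = nonbranch
    ; inner-disj = λ e e′ e≢e′ z∈ z∈′ → concat-tabulate-disjoint I uI e e′ e≢e′ (z∈ , z∈′) }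
    where
    ub = proj₁ (Unique-++⁻ (tabulate b) u)
    uI = proj₁ (proj₂ (Unique-++⁻ (tabulate b) u))
    b#I = proj₂ (proj₂ (Unique-++⁻ (tabulate b) u))
    nonbranch : ∀ e a → b a ∉ I e
    nonbranch e a a∈ = b#I (∈-tabulate⁺ a , ∈-concat-tabulate I e a∈)
    path-unique′ : ∀ e → Unique (b (source H e) ∷ I e ++ b (target H e) ∷ [])
    path-unique′ e = All.¬Any⇒All¬ _ s∉ ∷ Unique.++⁺ (concat-tabulate-unique I uI e) ([] ∷ []) t∉
      where
      s∉ : b (source H e) ∉ I e ++ b (target H e) ∷ []
      s∉ s∈ with ∈-++⁻ (I e) s∈
      ... | inj₁ s∈I = nonbranch e _ s∈I
      ... | inj₂ (here s≡t) = loopless e (tabulate-injective ub s≡t)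
      t∉ : Disjoint (I e) (b (target H e) ∷ [])
      t∉ (t∈ , here refl) = nonbranch e _ t∈

  VertexOf⇒∈ : ∀ T {z} → VertexOf T z → z ∈ tabulate (branch T) ++ concat (tabulate (inner T))
  VertexOf⇒∈ T (inj₁ (a , refl)) = ∈-++⁺ˡ (∈-tabulate⁺ a)
  VertexOf⇒∈ T (inj₂ (e , z∈)) = ∈-++⁺ʳ _ (∈-concat-tabulate (inner T) e z∈)

module _ {n} {G G′ : Graph n} {H : Pattern} (G⊆G′ : ∀ {u v} → Adj G u v → Adj G′ u v) where

  mapEmbedding : TopEmbedding H G → TopEmbedding H G′
  mapEmbedding T = record
    { branch = branch T ; branch-inj = branch-inj T ; inner = inner T
    ; path-adj = λ e → Linked.map G⊆G′ (path-adj T e) ; path-unique = path-unique T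
    ; inner-nonbranch = inner-nonbranch T ; inner-disj = inner-disj T }

module _ {n} {G : Graph n} {H : Pattern} (T : TopEmbedding H G) (e : Fin (length (edges H)))
         (P : Path (Adj G) (branch T (source H e)) (branch T (target H e)))
         (P⊆e : interior P ⊆ inner T e) where

  private
    route : ∀ e′ → Dec (e′ ≡ e) → Path (Adj G) (branch T (source H e′)) (branch T (target H e′))
    route e′ (yes refl) = P
    route e′ (no _)     = edgePath T e′

    route-⊆ : ∀ e′ e′≟e → interior (route e′ e′≟e) ⊆ inner T e′
    route-⊆ e′ (yes refl) = P⊆e
    route-⊆ e′ (no _)     = id

  reroute : TopEmbedding H G
  reroute = record
    { branch = branch T ; branch-inj = branch-inj T
    ; inner = λ e′ → interior (route e′ (e′ ≟ e))
    ; path-adj = λ e′ → linked (route e′ (e′ ≟ e))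
    ; path-unique = λ e′ → unique (route e′ (e′ ≟ e))
    ; inner-nonbranch = λ e′ a a∈ → inner-nonbranch T e′ a (route-⊆ e′ (e′ ≟ e) a∈)
    ; inner-disj = λ e₁ e₂ e₁≢e₂ z∈ z∈′ →
        inner-disj T e₁ e₂ e₁≢e₂ (route-⊆ e₁ (e₁ ≟ e) z∈) (route-⊆ e₂ (e₂ ≟ e) z∈′) }

  reroute-avoids : ∀ {v z} → v ∈ inner T e → v ∉ interior P → VertexOf reroute z → v ≢ z
  reroute-avoids v∈ v∉ (inj₁ (a , refl)) refl = inner-nonbranch T e a v∈
  reroute-avoids v∈ v∉ (inj₂ (e′ , z∈)) v≡z with e′ ≟ e
  reroute-avoids v∈ v∉ (inj₂ (e′ , z∈)) refl | yes refl = v∉ z∈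
  reroute-avoids v∈ v∉ (inj₂ (e′ , z∈)) refl | no e′≢e = inner-disj T e′ e e′≢e z∈ v∈

module _ {m} {G : Graph (suc m)} {H : Pattern} (v : Fin (suc m)) where

  punchOutAll : ∀ {zs} → All (v ≢_) zs → List (Fin m)
  punchOutAll []       = []
  punchOutAll (p ∷ ps) = punchOut p ∷ punchOutAll ps

  punchIn-punchOutAll : ∀ {zs} (ps : All (v ≢_) zs) → map (punchIn v) (punchOutAll ps) ≡ zs
  punchIn-punchOutAll []       = refl
  punchIn-punchOutAll (p ∷ ps) = cong₂ _∷_ (punchIn-punchOut p) (punchIn-punchOutAll ps)

  avoiding : (T : TopEmbedding H G) → (∀ {z} → VertexOf T z → v ≢ z) → TopEmbedding H (delete G v)
  avoiding T avoids = record
    { branch = branch′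
    ; branch-inj = λ eq →
        branch-inj T (trans (≡-sym (lift-branch _)) (trans (cong (punchIn v) eq) (lift-branch _)))
    ; inner = inner′
    ; path-adj = λ e → Linked.map⁻ (subst (Linked (Adj G)) (≡-sym (lift-path e)) (path-adj T e))
    ; path-unique = λ e → Unique.map⁻ (subst Unique (≡-sym (lift-path e)) (path-unique T e))
    ; inner-nonbranch = λ e a a∈ →
        inner-nonbranch T e a (subst (_∈ inner T e) (lift-branch a) (lift-inner e a∈))
    ; inner-disj = λ e e′ e≢e′ z∈ z∈′ →
        inner-disj T e e′ e≢e′ (lift-inner e z∈) (lift-inner e′ z∈′) }
    where
    branch′ : Fin (size H) → Fin m
    branch′ a = punchOut (avoids (inj₁ (a , refl)))
    inner′ : Fin (length (edges H)) → List (Fin m)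
    inner′ e = punchOutAll (All.tabulate (λ z∈ → avoids (inj₂ (e , z∈))))
    lift-branch : ∀ a → punchIn v (branch′ a) ≡ branch T a
    lift-branch a = punchIn-punchOut _
    lift-inner : ∀ e {z} → z ∈ inner′ e → punchIn v z ∈ inner T e
    lift-inner e z∈ = subst (_ ∈_) (punchIn-punchOutAll _) (∈-map⁺ (punchIn v) z∈)
    lift-path : ∀ e → map (punchIn v) (branch′ (source H e) ∷ inner′ e ++ branch′ (target H e) ∷ [])
                      ≡ pathOf T e
    lift-path e = cong₂ _∷_ (lift-branch _)
      (trans (map-++ (punchIn v) (inner′ e) _)
             (cong₂ _++_ (punchIn-punchOutAll _) (cong (_∷ []) (lift-branch _))))

-- Subdivided K4 from a bridged theta

module _ {n} {G : Graph n} where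

  record ThetaBridge (p q a b : Fin n) : Set where
    field
      P₁ P₂ P₃ : Path (Adj G) p q
      bridge   : Path (Adj G) a b
      a∈P₁     : a ∈ interior P₁
      b∈P₂     : b ∈ interior P₂
    pieces : List (List (Fin n))
    pieces = (p ∷ []) ∷ (q ∷ []) ∷ interior P₁ ∷ interior P₂ ∷ interior P₃ ∷ interior bridge ∷ []
    field
      pieces-disjoint : AllPairs Disjoint pieces

  -- Split the first two paths at the bridge ends: p, a, b, q become the branch vertices.
  thetaBridge⇒K4 : ∀ {p q a b} (Θ : ThetaBridge p q a b) →
                   Σ (TopEmbedding K4 G) λ K → ∀ {z} → VertexOf K z → z ∈ concat (ThetaBridge.pieces Θ)
  thetaBridge⇒K4 {p} {q} {a} {b} Θ =
    K , λ {z} z∈K → subst (z ∈_) (≡-sym pieces≡) (∈-resp-↭ rearrange (VertexOf⇒∈ K z∈K))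
    where
    open ThetaBridge Θ
    module S₁ = Split (split P₁ a∈P₁)
    module S₂ = Split (split P₂ b∈P₂)
    branches : Fin 4 → Fin n
    branches = Vec.lookup (p ∷ a ∷ b ∷ q ∷ [])
    inners : Fin 6 → List (Fin n)
    inners = Vec.lookup (interior S₁.before ∷ interior S₂.before ∷ interior P₃ ∷ interior bridge
                         ∷ interior S₁.after ∷ interior S₂.after ∷ [])
    adj : ∀ e → Linked (Adj G) (branches (source K4 e) ∷ inners e ++ branches (target K4 e) ∷ [])
    adj = λ { zero → linked S₁.before ; (suc zero) → linked S₂.before
            ; (suc (suc zero)) → linked P₃ ; (suc (suc (suc zero))) → linked bridge
            ; (suc (suc (suc (suc zero)))) → linked S₁.after
            ; (suc (suc (suc (suc (suc zero))))) → linked S₂.after }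
    theta-vertices : List (Fin n)
    theta-vertices = p ∷ q ∷ (interior S₁.before ++ a ∷ interior S₁.after)
      ++ (interior S₂.before ++ b ∷ interior S₂.after) ++ interior P₃ ++ interior bridge ++ []
    pieces≡ : concat pieces ≡ theta-vertices
    pieces≡ = cong₂ (λ I₁ I₂ → p ∷ q ∷ I₁ ++ I₂ ++ interior P₃ ++ interior bridge ++ [])
                    S₁.interior-≡ S₂.interior-≡
    rearrange : tabulate branches ++ concat (tabulate inners) ↭ theta-vertices
    rearrange = prove 10
      ((P ⊕ (A ⊕ (B ⊕ (Q ⊕ ε)))) ⊕ (A₁ ⊕ (A₂ ⊕ (I₃ ⊕ (R ⊕ (B₁ ⊕ (B₂ ⊕ ε)))))))
      (P ⊕ (Q ⊕ ((A₁ ⊕ (A ⊕ B₁)) ⊕ ((A₂ ⊕ (B ⊕ B₂)) ⊕ (I₃ ⊕ (R ⊕ ε))))))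
      ((p ∷ []) ∷ (q ∷ []) ∷ (a ∷ []) ∷ (b ∷ []) ∷ interior S₁.before ∷ interior S₁.after
        ∷ interior S₂.before ∷ interior S₂.after ∷ interior P₃ ∷ interior bridge ∷ [])
      where
      open import Algebra.Solver.CommutativeMonoid (++-commutativeMonoid {A = Fin n})
        using (prove; Expr; var; _⊕_) renaming (id to ε)
      P Q A B A₁ B₁ A₂ B₂ I₃ R : Expr 10
      P = var (# 0) ; Q = var (# 1) ; A = var (# 2) ; B = var (# 3) ; A₁ = var (# 4)
      B₁ = var (# 5) ; A₂ = var (# 6) ; B₂ = var (# 7) ; I₃ = var (# 8) ; R = var (# 9)
    pieces-unique : All Unique pieces
    pieces-unique = ([] ∷ []) ∷ ([] ∷ []) ∷ interior-unique P₁ ∷ interior-unique P₂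
                    ∷ interior-unique P₃ ∷ interior-unique bridge ∷ []
    K : TopEmbedding K4 G
    K = embedding (toWitness {a? = loopless? K4} _) branches inners adj
          (Unique-resp-↭ (↭-sym rearrange)
            (subst Unique pieces≡ (Unique.concat⁺ pieces-unique pieces-disjoint)))

-- A branch vertex of the prism, or the inside of one of its subdivided edges.
Location : Set
Location = Fin 6 ⊎ Fin 9

pattern vertex a = inj₁ a
pattern edge e = inj₂ e

_≟ᴸ_ : (l l′ : Location) → Dec (l ≡ l′)
_≟ᴸ_ = ≡-dec _≟_ _≟_

open import Data.List.Membership.DecPropositional _≟ᴸ_ using (_∈?_)
open import Data.List.Relation.Binary.Disjoint.DecPropositional _≟ᴸ_ using (disjoint?)
open import Data.List.Relation.Unary.Unique.DecPropositional _≟ᴸ_ using (unique?)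

closedEdge : Fin 9 → List Location
closedEdge e = vertex (source Prism e) ∷ edge e ∷ vertex (target Prism e) ∷ []

data Step : Fin 6 → Fin 6 → Set where
  fwd : ∀ e → Step (source Prism e) (target Prism e)
  bwd : ∀ e → Step (target Prism e) (source Prism e)

infixr 5 _∷_
data Walk : Fin 6 → Fin 6 → Set where
  [_] : ∀ {a b} → Step a b → Walk a b
  _∷_ : ∀ {a b c} → Step a b → Walk b c → Walk a c

edgeOf : ∀ {a b} → Step a b → Fin 9
edgeOf (fwd e) = e
edgeOf (bwd e) = e

region : ∀ {a b} → Walk a b → List Location
region [ s ] = edge (edgeOf s) ∷ []
region (_∷_ {b = b} s w) = edge (edgeOf s) ∷ vertex b ∷ region w

Simple : ∀ {a b} → Walk a b → Set
Simple {a} {b} w = Unique (vertex a ∷ region w ++ vertex b ∷ [])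

record Theta : Set where
  constructor theta
  field
    {p q}    : Fin 6
    W₁ W₂ W₃ : Walk p q
open Theta

thetaRegions : Theta → List Location → List (List Location)
thetaRegions θ Z = (vertex (p θ) ∷ []) ∷ (vertex (q θ) ∷ [])
                   ∷ region (W₁ θ) ∷ region (W₂ θ) ∷ region (W₃ θ) ∷ Z ∷ []

Separated : Theta → List Location → Set
Separated θ Z = Simple (W₁ θ) × Simple (W₂ θ) × Simple (W₃ θ) × AllPairs Disjoint (thetaRegions θ Z)

separated? : ∀ θ Z → Dec (Separated θ Z)
separated? θ Z = unique? _ ×-dec unique? _ ×-dec unique? _ ×-dec allPairs? disjoint? (thetaRegions θ Z)

-- For each edge pq of a triangle: the edge itself, the other way round the triangle,
-- and the way through the other triangle.
thetas : List Theta
thetas =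
    theta [ fwd (# 0) ] (fwd (# 2) ∷ [ bwd (# 1) ]) (fwd (# 6) ∷ fwd (# 3) ∷ [ bwd (# 7) ])
  ∷ theta [ fwd (# 1) ] (bwd (# 0) ∷ [ fwd (# 2) ]) (fwd (# 7) ∷ fwd (# 4) ∷ [ bwd (# 8) ])
  ∷ theta [ fwd (# 2) ] (fwd (# 0) ∷ [ fwd (# 1) ]) (fwd (# 6) ∷ fwd (# 5) ∷ [ bwd (# 8) ])
  ∷ theta [ fwd (# 3) ] (fwd (# 5) ∷ [ bwd (# 4) ]) (bwd (# 6) ∷ fwd (# 0) ∷ [ fwd (# 7) ])
  ∷ theta [ fwd (# 4) ] (bwd (# 3) ∷ [ fwd (# 5) ]) (bwd (# 7) ∷ fwd (# 1) ∷ [ fwd (# 8) ])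
  ∷ theta [ fwd (# 5) ] (fwd (# 3) ∷ [ fwd (# 4) ]) (bwd (# 6) ∷ fwd (# 2) ∷ [ fwd (# 8) ])
  ∷ []

orientations : Theta → List Theta
orientations (theta A B C) =
  theta A B C ∷ theta A C B ∷ theta B A C ∷ theta B C A ∷ theta C A B ∷ theta C B A ∷ []

-- The bridge of a theta starts either at x itself, or at an end c of the
-- subdivided edge containing x and runs along that edge to x.
data Anchor : Set where
  direct : Anchor
  fromEnd : Fin 6 → Anchor

data Plan : Set where
  chord   : Fin 9 → Plan
  bridged : Theta → Anchor → Plan

plans : List Plan
plans = map chord (allFin 9) ++ concatMap bridgings (concatMap orientations thetas)
  where bridgings = λ θ → map (bridged θ) (direct ∷ map fromEnd (allFin 6))

EndOf : Fin 6 → Location → Set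
EndOf c (vertex _) = ⊥
EndOf c (edge e)   = c ≡ source Prism e ⊎ c ≡ target Prism e

endOf? : ∀ c l → Dec (EndOf c l)
endOf? c (vertex _) = no λ ()
endOf? c (edge e)   = c ≟ source Prism e ⊎-dec c ≟ target Prism e

AnchorFits : Anchor → Location → Set
AnchorFits direct      lx = ⊤
AnchorFits (fromEnd c) lx = EndOf c lx

anchorFits? : ∀ κ lx → Dec (AnchorFits κ lx)
anchorFits? direct      lx = yes _
anchorFits? (fromEnd c) lx = endOf? c lx

anchorLocation : Anchor → Location → Location
anchorLocation direct      lx = lx
anchorLocation (fromEnd c) lx = vertex c

bridgeRegion : Anchor → Location → List Location
bridgeRegion direct      lx = []
bridgeRegion (fromEnd c) lx = lx ∷ []

Valid : Plan → Location → Location → Set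
Valid (chord e) lx ly = lx ∈ closedEdge e × ly ∈ closedEdge e
Valid (bridged θ κ) lx ly =
  AnchorFits κ lx × anchorLocation κ lx ∈ region (W₁ θ) × ly ∈ region (W₂ θ)
  × Any (λ w → vertex w ∉ concat (thetaRegions θ (bridgeRegion κ lx))) (allFin 6)
  × Separated θ (bridgeRegion κ lx)

valid? : ∀ π lx ly → Dec (Valid π lx ly)
valid? (chord e) lx ly = lx ∈? closedEdge e ×-dec ly ∈? closedEdge e
valid? (bridged θ κ) lx ly =
  anchorFits? κ lx ×-dec anchorLocation κ lx ∈? region (W₁ θ) ×-dec ly ∈? region (W₂ θ)
  ×-dec any? (λ w → ¬? (vertex w ∈? concat (thetaRegions θ (bridgeRegion κ lx)))) (allFin 6)
  ×-dec separated? θ (bridgeRegion κ lx)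

IsEdge : Location → Set
IsEdge (vertex _) = ⊥
IsEdge (edge _)   = ⊤

isEdge? : ∀ l → Dec (IsEdge l)
isEdge? (vertex _) = no λ ()
isEdge? (edge _)   = yes _

locations : List Location
locations = map vertex (allFin 6) ++ map edge (allFin 9)

-- The case analysis of the proof, decided by evaluation; opaque so that the large
-- witness is never unfolded during unification.
opaque
  coverage-table : All (λ lx → All (λ ly → lx ≢ ly ⊎ IsEdge lx → Any (λ π → Valid π lx ly) plans)
                                  locations)
                       locations
  coverage-table = toWitness {a? = all? (λ lx → all? (λ ly →
    (¬? (lx ≟ᴸ ly) ⊎-dec isEdge? lx) →-dec any? (λ π → valid? π lx ly) plans)
    locations) locations} _

∈-locations : ∀ l → l ∈ locations
∈-locations (vertex a) = ∈-++⁺ˡ (∈-map⁺ inj₁ (∈-allFin a))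
∈-locations (edge e)   = ∈-++⁺ʳ (map vertex (allFin 6)) (∈-map⁺ inj₂ (∈-allFin e))

coverage : ∀ lx ly → lx ≢ ly ⊎ IsEdge lx → Any (λ π → Valid π lx ly) plans
coverage lx ly = All.lookup (All.lookup coverage-table (∈-locations lx)) (∈-locations ly)

-- Subdivided prisms

module SubdividedPrism {n} {G : Graph n} (T : TopEmbedding Prism G) where

  _at_ : Fin n → Location → Set
  z at vertex a = branch T a ≡ z
  z at edge e   = z ∈ inner T e

  at-unique : ∀ {z l l′} → z at l → z at l′ → l ≡ l′
  at-unique {l = vertex a} {vertex b} refl b≡ = cong inj₁ (branch-inj T (≡-sym b≡))
  at-unique {l = vertex a} {edge e}   refl a∈ = ⊥-elim (inner-nonbranch T e a a∈)
  at-unique {l = edge e}   {vertex b} z∈ refl = ⊥-elim (inner-nonbranch T e b z∈)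
  at-unique {l = edge e}   {edge e′}  z∈ z∈′ with e ≟ e′
  ... | yes refl = refl
  ... | no e≢e′  = ⊥-elim (inner-disj T e e′ e≢e′ z∈ z∈′)

  Within : List Location → Fin n → Set
  Within X z = ∃[ l ] l ∈ X × z at l

  Within-⊆ : ∀ {X Y z} → X ⊆ Y → Within X z → Within Y z
  Within-⊆ X⊆Y (l , l∈X , pos) = l , X⊆Y l∈X , pos

  Within-disjoint : ∀ {X Y z} → Disjoint X Y → Within X z → Within Y z → ⊥
  Within-disjoint X#Y (l , l∈X , pos) (l′ , l′∈Y , pos′) with at-unique pos pos′
  ... | refl = X#Y (l∈X , l′∈Y)

  Within⇒VertexOf : ∀ {X z} → Within X z → VertexOf T z
  Within⇒VertexOf (vertex a , _ , a≡z) = inj₁ (a , a≡z)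
  Within⇒VertexOf (edge e , _ , z∈)   = inj₂ (e , z∈)

  Placed : List (Fin n) → List Location → Set
  Placed zs X = ∀ {z} → z ∈ zs → Within X z

  placed-disjoint : ∀ {zss Xs} → Pointwise Placed zss Xs → AllPairs Disjoint Xs → AllPairs Disjoint zss
  placed-disjoint [] [] = []
  placed-disjoint (zs⊆X ∷ placed) (X# ∷ disjoint) = apart placed X# ∷ placed-disjoint placed disjoint
    where
    apart : ∀ {zss Ys} → Pointwise Placed zss Ys → All (Disjoint _) Ys → All (Disjoint _) zss
    apart [] [] = []
    apart (ys⊆Y ∷ placed′) (X#Y ∷ X#Ys) =
      (λ (z∈ , z∈′) → Within-disjoint X#Y (zs⊆X z∈) (ys⊆Y z∈′)) ∷ apart placed′ X#Ys

  placed-concat : ∀ {zss Xs} → Pointwise Placed zss Xs → Placed (concat zss) (concat Xs)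
  placed-concat (zs⊆X ∷ placed) {z} z∈ with ∈-++⁻ _ z∈
  ... | inj₁ z∈zs  = Within-⊆ ∈-++⁺ˡ (zs⊆X z∈zs)
  ... | inj₂ z∈zss = Within-⊆ (∈-++⁺ʳ _) (placed-concat placed z∈zss)

  record Route (a b : Fin 6) (X : List Location) : Set where
    field
      track  : Path (Adj G) (branch T a) (branch T b)
      inside : Placed (interior track) X
      covers : ∀ {l z} → l ∈ X → z at l → z ∈ interior track
  open Route

  edgeRoute : ∀ e → Route (source Prism e) (target Prism e) (edge e ∷ [])
  edgeRoute e = record
    { track  = edgePath T e
    ; inside = λ z∈ → edge e , here refl , z∈
    ; covers = λ { (here refl) z∈ → z∈ } }

  reverseRoute : ∀ {a b X} → Route a b X → Route b a X
  reverseRoute Q = record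
    { track  = reversePath (sym G) (track Q)
    ; inside = inside Q ∘ Any.reverse⁻
    ; covers = λ l∈ pos → Any.reverse⁺ (covers Q l∈ pos) }

  joinRoute : ∀ {a b c X Y} → Route a c X → Route c b Y →
              Unique (vertex a ∷ X ++ vertex c ∷ Y ++ vertex b ∷ []) → Route a b (X ++ vertex c ∷ Y)
  joinRoute {a} {b} {c} {X} {Y} Q₁ Q₂ u = record
    { track  = join (track Q₁) (track Q₂) separate
    ; inside = inside′
    ; covers = covers′ }
    where
    X#Y : Disjoint (vertex a ∷ X) (vertex c ∷ Y ++ vertex b ∷ [])
    X#Y = proj₂ (proj₂ (Unique-++⁻ (vertex a ∷ X) u))
    separate : Disjoint (branch T a ∷ interior (track Q₁)) (interior (track Q₂) ++ branch T b ∷ [])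
    separate (z∈ , z∈′) = Within-disjoint X#Y (start-or-inside z∈) (inside-or-end z∈′)
      where
      start-or-inside : ∀ {z} → z ∈ branch T a ∷ interior (track Q₁) → Within (vertex a ∷ X) z
      start-or-inside (here refl) = vertex a , here refl , refl
      start-or-inside (there z∈I) = Within-⊆ there (inside Q₁ z∈I)
      inside-or-end : ∀ {z} → z ∈ interior (track Q₂) ++ branch T b ∷ [] →
                      Within (vertex c ∷ Y ++ vertex b ∷ []) z
      inside-or-end z∈ with ∈-++⁻ (interior (track Q₂)) z∈
      ... | inj₁ z∈I = Within-⊆ (there ∘ ∈-++⁺ˡ) (inside Q₂ z∈I)
      ... | inj₂ (here refl) = vertex b , there (∈-++⁺ʳ Y (here refl)) , refl
    inside′ : Placed (interior (track Q₁) ++ branch T c ∷ interior (track Q₂)) (X ++ vertex c ∷ Y)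
    inside′ z∈ with ∈-++⁻ (interior (track Q₁)) z∈
    ... | inj₁ z∈I = Within-⊆ ∈-++⁺ˡ (inside Q₁ z∈I)
    ... | inj₂ (here refl) = vertex c , ∈-++⁺ʳ X (here refl) , refl
    ... | inj₂ (there z∈I) = Within-⊆ (∈-++⁺ʳ X ∘ there) (inside Q₂ z∈I)
    covers′ : ∀ {l z} → l ∈ X ++ vertex c ∷ Y → z at l →
              z ∈ interior (track Q₁) ++ branch T c ∷ interior (track Q₂)
    covers′ l∈ pos with ∈-++⁻ X l∈
    ... | inj₁ l∈X = ∈-++⁺ˡ (covers Q₁ l∈X pos)
    ... | inj₂ (here refl) = ∈-++⁺ʳ _ (here (≡-sym pos))
    ... | inj₂ (there l∈Y) = ∈-++⁺ʳ _ (there (covers Q₂ l∈Y pos))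

  stepRoute : ∀ {a b} (s : Step a b) → Route a b (edge (edgeOf s) ∷ [])
  stepRoute (fwd e) = edgeRoute e
  stepRoute (bwd e) = reverseRoute (edgeRoute e)

  walkRoute : ∀ {a b} (w : Walk a b) → Simple w → Route a b (region w)
  walkRoute [ s ]   _ = stepRoute s
  walkRoute (s ∷ w) u = joinRoute (stepRoute s) (walkRoute w (AllPairs.tail (AllPairs.tail u))) u

  segment : ∀ {c e z} → z ∈ inner T e → c ≡ source Prism e ⊎ c ≡ target Prism e →
            Σ (Path (Adj G) (branch T c) z) λ P → interior P ⊆ inner T e
  segment {e = e} z∈ (inj₁ refl) =
    Split.before s , λ w∈ → subst (_ ∈_) (≡-sym (Split.interior-≡ s)) (∈-++⁺ˡ w∈)
    where s = split (edgePath T e) z∈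
  segment {e = e} z∈ (inj₂ refl) =
    reversePath (sym G) (Split.after s) ,
    λ w∈ → subst (_ ∈_) (≡-sym (Split.interior-≡ s)) (∈-++⁺ʳ _ (there (Any.reverse⁻ w∈)))
    where s = split (edgePath T e) z∈

  bridgedThetaK4 : ∀ θ Z → Separated θ Z → ∀ {a b} (R : Path (Adj G) a b) → Placed (interior R) Z →
            Within (region (W₁ θ)) a → Within (region (W₂ θ)) b →
            Σ (TopEmbedding K4 G) λ K → ∀ {z} → VertexOf K z → Within (concat (thetaRegions θ Z)) z
  bridgedThetaK4 θ Z (simple₁ , simple₂ , simple₃ , disjoint) R R⊆Z (l , l∈ , a-at) (l′ , l′∈ , b-at) =
    proj₁ K , placed-concat placed ∘ proj₂ K
    where
    Q₁ = walkRoute (W₁ θ) simple₁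
    Q₂ = walkRoute (W₂ θ) simple₂
    Q₃ = walkRoute (W₃ θ) simple₃
    placed : Pointwise Placed
      ((branch T (p θ) ∷ []) ∷ (branch T (q θ) ∷ []) ∷ interior (track Q₁) ∷ interior (track Q₂)
        ∷ interior (track Q₃) ∷ interior R ∷ [])
      (thetaRegions θ Z)
    placed = (λ { (here refl) → vertex (p θ) , here refl , refl })
           ∷ (λ { (here refl) → vertex (q θ) , here refl , refl })
           ∷ inside Q₁ ∷ inside Q₂ ∷ inside Q₃ ∷ R⊆Z ∷ []
    K = thetaBridge⇒K4 record
      { P₁ = track Q₁ ; P₂ = track Q₂ ; P₃ = track Q₃ ; bridge = R
      ; a∈P₁ = covers Q₁ l∈ a-at ; b∈P₂ = covers Q₂ l′∈ b-at
      ; pieces-disjoint = placed-disjoint placed disjoint }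

  prismK4 : Σ (TopEmbedding K4 G) λ K → ∀ {z} → VertexOf K z → VertexOf T z
  prismK4 = proj₁ K , Within⇒VertexOf ∘ proj₂ K
    where
    -- The theta on the triangle edge 01, bridged by the path 2–5–3.
    θ₀ : Theta
    θ₀ = theta (fwd (# 2) ∷ [ bwd (# 1) ]) (fwd (# 6) ∷ fwd (# 3) ∷ [ bwd (# 7) ]) [ fwd (# 0) ]
    rung : Walk (# 2) (# 3)
    rung = fwd (# 8) ∷ [ bwd (# 5) ]
    R = walkRoute rung (toWitness {a? = unique? _} _)
    K = bridgedThetaK4 θ₀ (region rung) (toWitness {a? = separated? θ₀ (region rung)} _)
          (track R) (inside R)
          (vertex (# 2) , there (here refl) , refl) (vertex (# 3) , there (here refl) , refl)

  located : ∀ {z} → VertexOf T z → ∃[ l ] z at l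
  located (inj₁ (a , a≡z)) = vertex a , a≡z
  located (inj₂ (e , z∈))  = edge e , z∈

  distinct-locations : ∀ {x y lx ly} → x at lx → y at ly → x ≢ y → lx ≢ ly ⊎ IsEdge lx
  distinct-locations {lx = edge e}   _     _     _   = inj₂ _
  distinct-locations {lx = vertex a} x-at y-at x≢y = inj₁ λ { refl → x≢y (trans (≡-sym x-at) y-at) }

  closedEdge-on-path : ∀ {e l z} → l ∈ closedEdge e → z at l → z ∈ pathOf T e
  closedEdge-on-path     (here refl)                 a≡z = here (≡-sym a≡z)
  closedEdge-on-path     (there (here refl))         z∈  = there (∈-++⁺ˡ z∈)
  closedEdge-on-path {e} (there (there (here refl))) b≡z =
    there (∈-++⁺ʳ (inner T e) (here (≡-sym b≡z)))

  outside : ∀ {w X z} → vertex w ∉ X → Within X z → branch T w ≢ z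
  outside {w} w∉X (l , l∈X , pos) w≡z with at-unique {l = vertex w} w≡z pos
  ... | refl = w∉X l∈X

-- Adding an edge

module _ {m} {S G : Graph (suc m)} {x y : Fin (suc m)} (T : TopEmbedding Prism S)
         (x≢y : x ≢ y) (¬Sxy : ¬ Adj S x y)
         (S⊆G : ∀ {u v} → Adj S u v → Adj G u v) (Gxy : Adj G x y) where

  private
    TG = mapEmbedding {G′ = G} S⊆G T
  open SubdividedPrism TG

  -- Shortcutting the subdivided edge through x and y frees one of its inner vertices.
  chordCase : ∀ e → x ∈ pathOf T e → y ∈ pathOf T e → HasProperK4Subdivision G
  chordCase e x∈ y∈ =
    skipped , avoiding skipped (proj₁ K)
      λ z∈K → reroute-avoids TG e bypass interior-⊆ skipped∈ skipped∉ (proj₂ K z∈K)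
    where
    open Shortcut (shortcut S⊆G (sym S) (sym G) (edgePath T e) x∈ y∈ x≢y ¬Sxy Gxy)
    K = SubdividedPrism.prismK4 (reroute TG e bypass interior-⊆)

  record Bridge (X Z : List Location) : Set where
    field
      anchor        : Fin (suc m)
      anchor-within : Within X anchor
      link          : Path (Adj G) anchor y
      link-inside   : Placed (interior link) Z

  bridgeFrom : ∀ κ {lx X Y} → AnchorFits κ lx → anchorLocation κ lx ∈ X → x at lx → Within Y y →
               Disjoint X Y → Disjoint (bridgeRegion κ lx) Y → Bridge X (bridgeRegion κ lx)
  bridgeFrom direct _ lx∈X x-at _ _ _ = record
    { anchor = x ; anchor-within = _ , lx∈X , x-at ; link = single Gxy x≢y ; link-inside = λ () }
  bridgeFrom (fromEnd c) {edge e} c-end c∈X x∈e y-within X#Y Z#Y = record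
    { anchor = branch T c ; anchor-within = vertex c , c∈X , refl
    ; link = join (proj₁ seg) (single Gxy x≢y) y-far ; link-inside = placed }
    where
    seg = segment x∈e c-end
    y-far : Disjoint (branch T c ∷ interior (proj₁ seg)) (y ∷ [])
    y-far (here refl , here refl) = Within-disjoint X#Y (vertex c , c∈X , refl) y-within
    y-far (there z∈  , here refl) = Within-disjoint Z#Y (edge e , here refl , proj₂ seg z∈) y-within
    placed : Placed (interior (proj₁ seg) ++ x ∷ []) (edge e ∷ [])
    placed z∈ with ∈-++⁻ (interior (proj₁ seg)) z∈
    ... | inj₁ z∈seg = edge e , here refl , proj₂ seg z∈seg
    ... | inj₂ (here refl) = edge e , here refl , x∈e

  realise : ∀ {lx ly} π → Valid π lx ly → x at lx → y at ly → HasProperK4Subdivision G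
  realise (chord e) (lx∈ , ly∈) x-at y-at =
    chordCase e (closedEdge-on-path lx∈ x-at) (closedEdge-on-path ly∈ y-at)
  realise {lx} {ly} (bridged θ κ) (fits , anchor∈ , ly∈ , free , separated) x-at y-at =
    branch T w , avoiding (branch T w) (proj₁ K) λ z∈K → outside w∉ (proj₂ K z∈K)
    where
    disjoint = proj₂ (proj₂ (proj₂ separated))
    W₁#W₂ : Disjoint (region (W₁ θ)) (region (W₂ θ))
    W₁#W₂ with disjoint
    ... | _ ∷ _ ∷ (d ∷ _) ∷ _ = d
    Z#W₂ : Disjoint (bridgeRegion κ lx) (region (W₂ θ))
    Z#W₂ with disjoint
    ... | _ ∷ _ ∷ _ ∷ (_ ∷ d ∷ []) ∷ _ = λ (z∈ , z∈′) → d (z∈′ , z∈)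
    open Bridge (bridgeFrom κ fits anchor∈ x-at (ly , ly∈ , y-at) W₁#W₂ Z#W₂)
    K = bridgedThetaK4 θ (bridgeRegion κ lx) separated link link-inside anchor-within (ly , ly∈ , y-at)
    w = proj₁ (Any.satisfied free)
    w∉ = proj₂ (Any.satisfied free)

mainTheorem15 : ∀ {n} (S G : Graph n) (x y : Fin n) →
    IsSubdivisionOf S Prism → AddEdge S x y G → HasProperK4Subdivision G
mainTheorem15 {zero} S G x y (T , _) _ with branch T zero
... | ()
mainTheorem15 {suc m} S G x y (T , covered , _) (x≢y , ¬Sxy , adj) =
  realise T x≢y ¬Sxy S⊆G Gxy (proj₁ plan) (proj₂ plan) (proj₂ x-loc) (proj₂ y-loc)
  where
  S⊆G : ∀ {u v} → Adj S u v → Adj G u v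
  S⊆G {u} {v} s = proj₂ (adj u v) (inj₁ s)
  Gxy = proj₂ (adj x y) (inj₂ (inj₁ (refl , refl)))
  open SubdividedPrism (mapEmbedding {G′ = G} S⊆G T) using (located; distinct-locations)
  x-loc = located (covered x)
  y-loc = located (covered y)
  plan = Any.satisfied (coverage _ _ (distinct-locations (proj₂ x-loc) (proj₂ y-loc) x≢y))
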